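{- For every integer $i\ge 0$ there exist a finite, simple, connected graph $G$ and a graphoidal cover $\psi$ of $G$ such that $|D'(G)-D(\Omega(G,\psi))| = i$.
   Context: A graphoidal cover of a graph $G$ is a collection $\psi$ of (not necessarily open) paths in $G$ — cycles are allowed as closed paths, with a designated starting vertex as their terminal vertex and all other vertices internal — such that: every path in $\psi$ has at least two vertices; every vertex of $G$ is an internal vertex of at most one path in $\psi$; every edge of $G$ lies in exactly one path in $\psi$. $\Omega(G,\psi)$ is the intersection graph of $\psi$: its vertices are the paths in $\psi$, two being adjacent iff they share a vertex. $D(H)$ (distinguishing number) is the least $r$ such that $H$ has a vertex labeling with $r$ labels preserved only by the identity automorphism; $D'(H)$ (distinguishing index) is the least $d$ such that $H$ has an edge labeling with $d$ labels preserved only by the identity automorphism. -}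

module Defs where

open import Data.Nat using (ℕ; zero; suc; _≤_; _<_)
open import Data.Fin using (Fin; zero; suc; toℕ; inject₁; fromℕ)
open import Data.Fin.Permutation using (Permutation′; _⟨$⟩ʳ_)
open import Data.Product using (Σ; ∃; ∃-syntax; _×_; _,_)
open import Data.Sum using (_⊎_)
open import Relation.Nullary using (¬_)
open import Relation.Binary.PropositionalEquality using (_≡_; _≢_)

record Graph (n : ℕ) : Set₁ where
  field
    Adj    : Fin n → Fin n → Set
    sym    : ∀ {u v} → Adj u v → Adj v u
    irrefl : ∀ {v} → ¬ Adj v v
open Graph public

data Reach {n : ℕ} (G : Graph n) (u : Fin n) : Fin n → Set where
  here : Reach G u u
  step : ∀ {v w} → Reach G u v → Adj G v w → Reach G u w

Connected : ∀ {n} → Graph n → Set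
Connected G = ∀ u v → Reach G u v

-- A path with `len` edges is a vertex sequence vert 0, …, vert len,
-- consecutive vertices adjacent, all vertices distinct, except that a
-- closed path (cycle, len ≥ 3) has vert 0 ≡ vert len.

record GPath {n : ℕ} (G : Graph n) : Set where
  field
    len      : ℕ
    vert     : Fin (suc len) → Fin n
    twoVerts : 1 ≤ len
    adjacent : ∀ (i : Fin len) → Adj G (vert (inject₁ i)) (vert (suc i))
    distinct : ∀ (i j : Fin (suc len)) → vert i ≡ vert j →
               i ≡ j
               ⊎ (3 ≤ len × ((i ≡ zero × j ≡ fromℕ len) ⊎ (i ≡ fromℕ len × j ≡ zero)))
open GPath public

OnPath : ∀ {n} {G : Graph n} → GPath G → Fin n → Set
OnPath P v = ∃[ i ] vert P i ≡ v

Internal : ∀ {n} {G : Graph n} → GPath G → Fin n → Set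
Internal P v = ∃[ i ] (0 < toℕ i × toℕ i < len P × vert P i ≡ v)

ContainsEdge : ∀ {n} {G : Graph n} → GPath G → Fin n → Fin n → Set
ContainsEdge P a b = ∃[ i ]
  ((vert P (inject₁ i) ≡ a × vert P (suc i) ≡ b)
   ⊎ (vert P (inject₁ i) ≡ b × vert P (suc i) ≡ a))

record GraphoidalCover {n : ℕ} (G : Graph n) : Set where
  field
    size  : ℕ
    path  : Fin size → GPath G
    internalAtMostOnce : ∀ v j k → Internal (path j) v → Internal (path k) v → j ≡ k
    edgeExactlyOnce    : ∀ a b → Adj G a b →
      ∃[ j ] (ContainsEdge (path j) a b × (∀ k → ContainsEdge (path k) a b → k ≡ j))
open GraphoidalCover public

Ω : ∀ {n} (G : Graph n) (ψ : GraphoidalCover G) → Graph (size ψ)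
Ω G ψ = record
  { Adj    = λ j k → j ≢ k × ∃[ v ] (OnPath (path ψ j) v × OnPath (path ψ k) v)
  ; sym    = λ { (j≢k , v , p , q) → (λ e → j≢k (symm e)) , v , q , p }
  ; irrefl = λ { (j≢j , _) → j≢j Relation.Binary.PropositionalEquality.refl }
  }
  where
    symm = Relation.Binary.PropositionalEquality.sym

IsAutomorphism : ∀ {n} → Graph n → Permutation′ n → Set
IsAutomorphism G σ = ∀ u v →
  (Adj G u v → Adj G (σ ⟨$⟩ʳ u) (σ ⟨$⟩ʳ v)) × (Adj G (σ ⟨$⟩ʳ u) (σ ⟨$⟩ʳ v) → Adj G u v)

IsIdentity : ∀ {n} → Permutation′ n → Set
IsIdentity σ = ∀ v → σ ⟨$⟩ʳ v ≡ v

DistinguishingLabeling : ∀ {n} → Graph n → (r : ℕ) → (Fin n → Fin r) → Set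
DistinguishingLabeling G r c = ∀ σ → IsAutomorphism G σ →
  (∀ v → c (σ ⟨$⟩ʳ v) ≡ c v) → IsIdentity σ

HasDistLabeling : ∀ {n} → Graph n → ℕ → Set
HasDistLabeling {n} G r = Σ (Fin n → Fin r) (DistinguishingLabeling G r)

IsDistNumber : ∀ {n} → Graph n → ℕ → Set
IsDistNumber G r = HasDistLabeling G r × (∀ s → s < r → ¬ HasDistLabeling G s)

record EdgeLabeling {n : ℕ} (G : Graph n) (d : ℕ) : Set where
  field
    lab      : ∀ u v → Adj G u v → Fin d
    wellDef  : ∀ u v (p : Adj G u v) (q : Adj G u v) → lab u v p ≡ lab u v q
    symmetric : ∀ u v (p : Adj G u v) (q : Adj G v u) → lab u v p ≡ lab v u q
open EdgeLabeling public

DistinguishingEdgeLabeling : ∀ {n} (G : Graph n) (d : ℕ) → EdgeLabeling G d → Set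
DistinguishingEdgeLabeling G d f = ∀ σ → IsAutomorphism G σ →
  (∀ u v (p : Adj G u v) (q : Adj G (σ ⟨$⟩ʳ u) (σ ⟨$⟩ʳ v)) →
     lab f (σ ⟨$⟩ʳ u) (σ ⟨$⟩ʳ v) q ≡ lab f u v p) → IsIdentity σ

HasDistEdgeLabeling : ∀ {n} → Graph n → ℕ → Set
HasDistEdgeLabeling G d = Σ (EdgeLabeling G d) (DistinguishingEdgeLabeling G d)

IsDistIndex : ∀ {n} → Graph n → ℕ → Set
IsDistIndex G d = HasDistEdgeLabeling G d × (∀ s → s < d → ¬ HasDistEdgeLabeling G s)

module Submission where

-- For every i we build a "spider" S_i and a graphoidal cover ψ of it with
-- D'(S_i) = i + 3 and D(Ω(S_i, ψ)) = 2i + 3.  S_i has a centre with i + 3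
-- pendant leaves and i legs centre – knee – foot of length two; ψ consists
-- of the i + 3 pendant edges and the i legs, viewed as paths.
--
-- For the spider, Ω is complete since every path
-- contains the centre, giving D(Ω) = 2i + 3; the i + 3 leaves give
-- D' ≥ i + 3, and labelling each edge by the path of ψ containing it (leaf t
-- gets t, leg j gets 3 + j) is distinguishing because the labelled spider
-- is rigid, giving D' = i + 3.  The difference is |(i + 3) - (2i + 3)| = i.

open import Defs hiding (sym)
open import Data.Nat using (ℕ; suc; _+_; _<_; _≤_; z≤n; s≤s; ∣_-_∣)
open import Data.Nat.Properties using (∣m-m+n∣≡n)
open import Data.Fin using (Fin; zero; suc; toℕ; inject₁; _↑ˡ_; _↑ʳ_; splitAt; join; _≟_)
open import Data.Fin.Properties
  using (splitAt-↑ˡ; splitAt-↑ʳ; splitAt-join; join-splitAt; ↑ʳ-injective; toℕ-injective; pigeonhole; <⇒≢)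
open import Data.Fin.Permutation using (Permutation′; _⟨$⟩ʳ_; _⟨$⟩ˡ_; inverseˡ; transpose)
import Data.Fin.Permutation.Components as PC
open import Data.Product using (Σ; ∃; ∃-syntax; _×_; _,_; proj₁; proj₂; swap)
open import Data.Sum using (_⊎_; inj₁; inj₂)
open import Data.Unit using (⊤; tt)
open import Data.Empty using (⊥; ⊥-elim)
open import Function using (_∘_)
open import Relation.Nullary using (¬_; yes; no)
open import Relation.Nullary.Decidable using (dec-true; dec-false)
open import Relation.Binary.PropositionalEquality
  using (_≡_; _≢_; refl; sym; trans; cong; subst; subst₂; module ≡-Reasoning)

data TranspositionCase {n : ℕ} (a b k : Fin n) : Set where
  hits-a : k ≡ a → transpose a b ⟨$⟩ʳ k ≡ b → TranspositionCase a b k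
  hits-b : k ≡ b → transpose a b ⟨$⟩ʳ k ≡ a → TranspositionCase a b k
  misses : k ≢ a → k ≢ b → transpose a b ⟨$⟩ʳ k ≡ k → TranspositionCase a b k

transposition-case : ∀ {n} (a b k : Fin n) → TranspositionCase a b k
transposition-case a b k with k ≟ a | k ≟ b
... | yes k≡a | _ = hits-a k≡a to-b
  where
  to-b : transpose a b ⟨$⟩ʳ k ≡ b
  to-b rewrite dec-true (k ≟ a) k≡a = refl
... | no k≢a | yes k≡b = hits-b k≡b to-a
  where
  to-a : transpose a b ⟨$⟩ʳ k ≡ a
  to-a rewrite dec-false (k ≟ a) k≢a | dec-true (k ≟ b) k≡b = refl
... | no k≢a | no k≢b = misses k≢a k≢b fixed
  where
  fixed : transpose a b ⟨$⟩ʳ k ≡ k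
  fixed rewrite dec-false (k ≟ a) k≢a | dec-false (k ≟ b) k≢b = refl

transposition-fixes : ∀ {n} {a b k : Fin n} → k ≢ a → k ≢ b → transpose a b ⟨$⟩ʳ k ≡ k
transposition-fixes {a = a} {b} {k} k≢a k≢b with transposition-case a b k
... | hits-a k≡a _ = ⊥-elim (k≢a k≡a)
... | hits-b k≡b _ = ⊥-elim (k≢b k≡b)
... | misses _ _ τk≡k = τk≡k

transposition-identity⇒equal : ∀ {n} {a b : Fin n} → IsIdentity (transpose a b) → a ≡ b
transposition-identity⇒equal {a = a} {b} id with transposition-case a b a
... | hits-a _ τa≡b = trans (sym (id a)) τa≡b
... | hits-b a≡b _ = a≡b
... | misses a≢a _ _ = ⊥-elim (a≢a refl)

transposition-preserves-labelling : ∀ {n} {A : Set} (c : Fin n → A) {a b : Fin n} →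
  c a ≡ c b → ∀ k → c (transpose a b ⟨$⟩ʳ k) ≡ c k
transposition-preserves-labelling c {a} {b} ca≡cb k with transposition-case a b k
... | hits-a k≡a τk≡b = trans (cong c τk≡b) (trans (sym ca≡cb) (cong c (sym k≡a)))
... | hits-b k≡b τk≡a = trans (cong c τk≡a) (trans ca≡cb (cong c (sym k≡b)))
... | misses _ _ τk≡k = cong c τk≡k

reach-trans : ∀ {n} {G : Graph n} {u v w} → Reach G u v → Reach G v w → Reach G u w
reach-trans r here = r
reach-trans r (step s a) = step (reach-trans r s) a

reach-sym : ∀ {n} {G : Graph n} {u v} → Reach G u v → Reach G v u
reach-sym here = here
reach-sym {G = G} (step r a) = reach-trans (step here (Graph.sym G a)) (reach-sym r)

rooted⇒connected : ∀ {n} {G : Graph n} (root : Fin n) → (∀ v → Reach G root v) → Connected G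
rooted⇒connected root reach u v = reach-trans (reach-sym (reach u)) (reach v)

module _ {n : ℕ} (G : Graph n) where

  adj-along : ∀ {u u' v v'} → u ≡ u' → v ≡ v' → Adj G u v → Adj G u' v'
  adj-along refl refl p = p

  Twins : Fin n → Fin n → Set
  Twins a b = ∀ w → w ≢ a → w ≢ b → (Adj G a w → Adj G b w) × (Adj G b w → Adj G a w)

  twins-sym : ∀ {a b} → Twins a b → Twins b a
  twins-sym tw w w≢b w≢a = swap (tw w w≢a w≢b)

  twins-transposition-preserves-adj : ∀ {a b} → Twins a b →
    ∀ u v → Adj G u v → Adj G (transpose a b ⟨$⟩ʳ u) (transpose a b ⟨$⟩ʳ v)
  twins-transposition-preserves-adj {a} {b} tw u v p
    with transposition-case a b u | transposition-case a b v
  ... | hits-a u≡a _ | hits-a v≡a _ = ⊥-elim (irrefl G (adj-along u≡a v≡a p))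
  ... | hits-b u≡b _ | hits-b v≡b _ = ⊥-elim (irrefl G (adj-along u≡b v≡b p))
  ... | hits-a u≡a τu | hits-b v≡b τv = adj-along (sym τu) (sym τv) (Graph.sym G (adj-along u≡a v≡b p))
  ... | hits-b u≡b τu | hits-a v≡a τv = adj-along (sym τu) (sym τv) (Graph.sym G (adj-along u≡b v≡a p))
  ... | hits-a u≡a τu | misses v≢a v≢b τv =
    adj-along (sym τu) (sym τv) (proj₁ (tw v v≢a v≢b) (adj-along u≡a refl p))
  ... | hits-b u≡b τu | misses v≢a v≢b τv =
    adj-along (sym τu) (sym τv) (proj₂ (tw v v≢a v≢b) (adj-along u≡b refl p))
  ... | misses u≢a u≢b τu | hits-a v≡a τv =
    adj-along (sym τu) (sym τv) (Graph.sym G (proj₁ (tw u u≢a u≢b) (Graph.sym G (adj-along refl v≡a p))))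
  ... | misses u≢a u≢b τu | hits-b v≡b τv =
    adj-along (sym τu) (sym τv) (Graph.sym G (proj₂ (tw u u≢a u≢b) (Graph.sym G (adj-along refl v≡b p))))
  ... | misses _ _ τu | misses _ _ τv = adj-along (sym τu) (sym τv) p

  twins-transposition-automorphism : ∀ {a b} → Twins a b → IsAutomorphism G (transpose a b)
  twins-transposition-automorphism {a} {b} tw u v =
      twins-transposition-preserves-adj tw u v
    , λ q → adj-along (PC.transpose-inverse b a) (PC.transpose-inverse b a)
              (twins-transposition-preserves-adj (twins-sym tw) _ _ q)

  IsComplete : Set
  IsComplete = ∀ u v → u ≢ v → Adj G u v

  complete⇒twins : IsComplete → ∀ a b → Twins a b
  complete⇒twins complete a b w w≢a w≢b =
    (λ _ → complete b w (w≢b ∘ sym)) , (λ _ → complete a w (w≢a ∘ sym))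

  -- The complete graph on n vertices needs n labels: the identity labelling
  -- distinguishes, and with fewer labels two vertices share a label and
  -- may be swapped.
  complete-distNumber : IsComplete → IsDistNumber G n
  complete-distNumber complete = ((λ v → v) , λ σ _ preserves → preserves) , fewer-labels
    where
    fewer-labels : ∀ s → s < n → ¬ HasDistLabeling G s
    fewer-labels s s<n (c , distinguishing) with pigeonhole s<n c
    ... | a , b , a<b , ca≡cb = <⇒≢ a<b (transposition-identity⇒equal
            (distinguishing (transpose a b)
              (twins-transposition-automorphism (complete⇒twins complete a b))
              (transposition-preserves-labelling c ca≡cb)))

  label-along : ∀ {d} (f : EdgeLabeling G d) {u u' v v'} → u ≡ u' → v ≡ v' →
    ∀ p p' → lab f u v p ≡ lab f u' v' p'
  label-along f refl refl = wellDef f _ _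

  pendant-twins : ∀ {a b c} → Adj G c b → Adj G c a →
    (∀ w → Adj G a w → w ≡ c) → (∀ w → Adj G b w → w ≡ c) → Twins a b
  pendant-twins cb ca a-pendant b-pendant w _ _ =
      (λ aw → adj-along refl (sym (a-pendant w aw)) (Graph.sym G cb))
    , (λ bw → adj-along refl (sym (b-pendant w bw)) (Graph.sym G ca))

  -- Swapping two pendant vertices whose pendant edges have the same label
  -- preserves an edge labelling: only those two edges are moved.
  pendant-transposition-preserves-labels : ∀ {d} (f : EdgeLabeling G d) {a b c}
    (ca : Adj G c a) (cb : Adj G c b) →
    (∀ w → Adj G a w → w ≡ c) → (∀ w → Adj G b w → w ≡ c) →
    lab f c a ca ≡ lab f c b cb →
    ∀ u v (p : Adj G u v) (q : Adj G (transpose a b ⟨$⟩ʳ u) (transpose a b ⟨$⟩ʳ v)) →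
    lab f (transpose a b ⟨$⟩ʳ u) (transpose a b ⟨$⟩ʳ v) q ≡ lab f u v p
  pendant-transposition-preserves-labels f {a} {b} {c} ca cb a-pendant b-pendant same = preserves
    where
    τ : Fin n → Fin n
    τ = transpose a b ⟨$⟩ʳ_

    IsLeaf : Fin n → Set
    IsLeaf x = x ≡ a ⊎ x ≡ b

    leaf-neighbour : ∀ {x w} → IsLeaf x → Adj G x w → w ≡ c
    leaf-neighbour (inj₁ x≡a) xw = a-pendant _ (adj-along x≡a refl xw)
    leaf-neighbour (inj₂ x≡b) xw = b-pendant _ (adj-along x≡b refl xw)

    c-fixed : τ c ≡ c
    c-fixed = transposition-fixes (λ c≡a → irrefl G (adj-along c≡a refl ca))
                                  (λ c≡b → irrefl G (adj-along c≡b refl cb))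

    leaf-label : ∀ {x y} → IsLeaf x → y ≡ c → ∀ p → lab f x y p ≡ lab f c a ca
    leaf-label (inj₁ x≡a) y≡c xy =
      trans (label-along f x≡a y≡c xy (Graph.sym G ca)) (symmetric f a c _ ca)
    leaf-label (inj₂ x≡b) y≡c xy =
      trans (label-along f x≡b y≡c xy (Graph.sym G cb)) (trans (symmetric f b c _ cb) (sym same))

    leaf-edge : ∀ {x y} → IsLeaf x → IsLeaf (τ x) → (p : Adj G x y) (q : Adj G (τ x) (τ y)) →
      lab f (τ x) (τ y) q ≡ lab f x y p
    leaf-edge x-leaf τx-leaf p q = trans (leaf-label τx-leaf τy≡c q) (sym (leaf-label x-leaf y≡c p))
      where
      y≡c = leaf-neighbour x-leaf p
      τy≡c = trans (cong τ y≡c) c-fixed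

    reversed-leaf-edge : ∀ {x y} → IsLeaf y → IsLeaf (τ y) → (p : Adj G x y) (q : Adj G (τ x) (τ y)) →
      lab f (τ x) (τ y) q ≡ lab f x y p
    reversed-leaf-edge y-leaf τy-leaf p q =
      trans (symmetric f _ _ q (Graph.sym G q))
        (trans (leaf-edge y-leaf τy-leaf (Graph.sym G p) (Graph.sym G q)) (symmetric f _ _ (Graph.sym G p) p))

    preserves : ∀ u v (p : Adj G u v) (q : Adj G (τ u) (τ v)) → lab f (τ u) (τ v) q ≡ lab f u v p
    preserves u v p q with transposition-case a b u | transposition-case a b v
    ... | hits-a u≡a τu≡b | _ = leaf-edge (inj₁ u≡a) (inj₂ τu≡b) p q
    ... | hits-b u≡b τu≡a | _ = leaf-edge (inj₂ u≡b) (inj₁ τu≡a) p q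
    ... | misses _ _ _ | hits-a v≡a τv≡b = reversed-leaf-edge (inj₁ v≡a) (inj₂ τv≡b) p q
    ... | misses _ _ _ | hits-b v≡b τv≡a = reversed-leaf-edge (inj₂ v≡b) (inj₁ τv≡a) p q
    ... | misses _ _ τu≡u | misses _ _ τv≡v = label-along f τu≡u τv≡v q p

  -- A vertex c with k pendant neighbours forces D'(G) ≥ k: with fewer
  -- labels two pendant edges at c share a label, and swapping their leaves
  -- is a non-trivial automorphism preserving the labelling.
  pendant-lower-bound : ∀ {k} (c : Fin n) (leaf : Fin k → Fin n) →
    (∀ t → Adj G c (leaf t)) → (∀ t w → Adj G (leaf t) w → w ≡ c) →
    (∀ {t t'} → leaf t ≡ leaf t' → t ≡ t') →
    ∀ s → s < k → ¬ HasDistEdgeLabeling G s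
  pendant-lower-bound c leaf attached pendant leaf-injective s s<k (f , distinguishing)
    with pigeonhole s<k (λ t → lab f c (leaf t) (attached t))
  ... | t , t' , t<t' , same = <⇒≢ t<t' (leaf-injective (transposition-identity⇒equal
          (distinguishing (transpose (leaf t) (leaf t'))
            (twins-transposition-automorphism
              (pendant-twins (attached t') (attached t) (pendant t) (pendant t')))
            (pendant-transposition-preserves-labels f (attached t) (attached t')
              (pendant t) (pendant t') same))))

common-vertex⇒Ω-complete : ∀ {n} {G : Graph n} (ψ : GraphoidalCover G) (v : Fin n) →
  (∀ j → OnPath (path ψ j) v) → IsComplete (Ω G ψ)
common-vertex⇒Ω-complete ψ v through j k j≢k = j≢k , v , through j , through k

-- A graph on Fin n described on a vertex type V in bijection with Fin n,
-- by a symmetric irreflexive relation R.  Paths, edge labellings and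
-- automorphisms can then be handled on V.
module Presented {V : Set} {n : ℕ} (enc : V → Fin n) (dec : Fin n → V)
  (dec-enc : ∀ x → dec (enc x) ≡ x) (enc-dec : ∀ u → enc (dec u) ≡ u)
  (R : V → V → Set) (R-sym : ∀ {x y} → R x y → R y x) (R-irrefl : ∀ {x} → ¬ R x x) where

  graph : Graph n
  graph = record { Adj = λ u v → R (dec u) (dec v) ; sym = R-sym ; irrefl = R-irrefl }

  enc-injective : ∀ {x y} → enc x ≡ enc y → x ≡ y
  enc-injective {x} {y} e = trans (sym (dec-enc x)) (trans (cong dec e) (dec-enc y))

  adj-enc : ∀ {x y} → R x y → Adj graph (enc x) (enc y)
  adj-enc {x} {y} = subst₂ R (sym (dec-enc x)) (sym (dec-enc y))

  adj-from-enc : ∀ {x u} → Adj graph (enc x) u → R x (dec u)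
  adj-from-enc {x} {u} = subst (λ z → R z (dec u)) (dec-enc x)

  connected-from : ∀ root → (∀ x → Reach graph (enc root) (enc x)) → Connected graph
  connected-from root reach =
    rooted⇒connected (enc root) (λ u → subst (Reach graph (enc root)) (enc-dec u) (reach (dec u)))

  WalkEdge : ∀ {len} → (Fin (suc len) → V) → V → V → Set
  WalkEdge {len} walk x y = ∃ λ (p : Fin len) →
    (walk (inject₁ p) ≡ x × walk (suc p) ≡ y) ⊎ (walk (inject₁ p) ≡ y × walk (suc p) ≡ x)

  walk-edge-sym : ∀ {len} (walk : Fin (suc len) → V) {x y} → WalkEdge walk x y → WalkEdge walk y x
  walk-edge-sym _ (p , inj₁ xy) = p , inj₂ xy
  walk-edge-sym _ (p , inj₂ yx) = p , inj₁ yx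

  module WalkPath (len : ℕ) (walk : Fin (suc len) → V) (1≤len : 1 ≤ len)
    (steps : ∀ p → R (walk (inject₁ p)) (walk (suc p)))
    (injective : ∀ p q → walk p ≡ walk q → p ≡ q) where

    as-path : GPath graph
    as-path = record
      { len      = len
      ; vert     = enc ∘ walk
      ; twoVerts = 1≤len
      ; adjacent = λ p → adj-enc (steps p)
      ; distinct = λ p q e → inj₁ (injective p q (enc-injective e))
      }

    contains-edge→walk-edge : ∀ {a b} → ContainsEdge as-path a b → WalkEdge walk (dec a) (dec b)
    contains-edge→walk-edge (p , inj₁ (e₁ , e₂)) =
      p , inj₁ (trans (sym (dec-enc _)) (cong dec e₁) , trans (sym (dec-enc _)) (cong dec e₂))
    contains-edge→walk-edge (p , inj₂ (e₁ , e₂)) =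
      p , inj₂ (trans (sym (dec-enc _)) (cong dec e₁) , trans (sym (dec-enc _)) (cong dec e₂))

    walk-edge→contains-edge : ∀ {a b} → WalkEdge walk (dec a) (dec b) → ContainsEdge as-path a b
    walk-edge→contains-edge {a} {b} (p , inj₁ (e₁ , e₂)) =
      p , inj₁ (trans (cong enc e₁) (enc-dec a) , trans (cong enc e₂) (enc-dec b))
    walk-edge→contains-edge {a} {b} (p , inj₂ (e₁ , e₂)) =
      p , inj₂ (trans (cong enc e₁) (enc-dec b) , trans (cong enc e₂) (enc-dec a))

  conj : Permutation′ n → V → V
  conj σ x = dec (σ ⟨$⟩ʳ enc x)

  conj-injective : ∀ σ {x y} → conj σ x ≡ conj σ y → x ≡ y
  conj-injective σ {x} {y} e =
    enc-injective (trans (sym (inverseˡ σ)) (trans (cong (σ ⟨$⟩ˡ_) σx≡σy) (inverseˡ σ)))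
    where
    σx≡σy : σ ⟨$⟩ʳ enc x ≡ σ ⟨$⟩ʳ enc y
    σx≡σy = trans (sym (enc-dec _)) (trans (cong enc e) (enc-dec _))

  conj-adj : ∀ σ → IsAutomorphism graph σ → ∀ {x y} → R x y → R (conj σ x) (conj σ y)
  conj-adj σ aut {x} {y} r = proj₁ (aut (enc x) (enc y)) (adj-enc r)

  conj-identity : ∀ σ → (∀ x → conj σ x ≡ x) → IsIdentity σ
  conj-identity σ fixes u = begin
    σ ⟨$⟩ʳ u                     ≡⟨ sym (enc-dec _) ⟩
    enc (dec (σ ⟨$⟩ʳ u))         ≡⟨ cong (λ v → enc (dec (σ ⟨$⟩ʳ v))) (sym (enc-dec u)) ⟩
    enc (conj σ (dec u))         ≡⟨ cong enc (fixes (dec u)) ⟩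
    enc (dec u)                  ≡⟨ enc-dec u ⟩
    u                            ∎
    where open ≡-Reasoning

  module Labelling {d : ℕ} (L : ∀ x y → R x y → Fin d)
    (L-irrelevant : ∀ x y p q → L x y p ≡ L x y q)
    (L-sym : ∀ x y p q → L x y p ≡ L y x q) where

    L-along : ∀ {x x' y y'} → x ≡ x' → y ≡ y' → ∀ p p' → L x y p ≡ L x' y' p'
    L-along refl refl = L-irrelevant _ _

    induced-labelling : EdgeLabeling graph d
    induced-labelling = record
      { lab       = λ u v → L (dec u) (dec v)
      ; wellDef   = λ u v → L-irrelevant (dec u) (dec v)
      ; symmetric = λ u v → L-sym (dec u) (dec v)
      }

    LabelRigid : Set
    LabelRigid = ∀ (s : V → V) → (∀ {x y} → R x y → R (s x) (s y)) →
      (∀ {x y} → s x ≡ s y → x ≡ y) → (∀ x y p q → L (s x) (s y) q ≡ L x y p) → ∀ x → s x ≡ x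

    rigid⇒distinguishing : LabelRigid → DistinguishingEdgeLabeling graph d induced-labelling
    rigid⇒distinguishing rigid σ aut preserves =
      conj-identity σ (rigid (conj σ) (conj-adj σ aut) (conj-injective σ) conj-preserves)
      where
      conj-preserves : ∀ x y p q → L (conj σ x) (conj σ y) q ≡ L x y p
      conj-preserves x y p q =
        trans (preserves (enc x) (enc y) (adj-enc p) q) (L-along (dec-enc x) (dec-enc y) _ p)

module Spider (i : ℕ) where

  d : ℕ
  d = 3 + i

  data V : Set where
    center    : V
    leaf      : Fin d → V
    knee foot : Fin i → V

  -- S_i has suc n vertices.
  n : ℕ
  n = d + (i + i)

  enc : V → Fin (suc n)
  enc center   = zero
  enc (leaf t) = suc (t ↑ˡ (i + i))
  enc (knee j) = suc (d ↑ʳ (j ↑ˡ i))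
  enc (foot j) = suc (d ↑ʳ (i ↑ʳ j))

  leg-vertex : Fin i ⊎ Fin i → V
  leg-vertex (inj₁ j) = knee j
  leg-vertex (inj₂ j) = foot j

  outer-vertex : Fin d ⊎ Fin (i + i) → V
  outer-vertex (inj₁ t) = leaf t
  outer-vertex (inj₂ y) = leg-vertex (splitAt i y)

  dec : Fin (suc n) → V
  dec zero    = center
  dec (suc x) = outer-vertex (splitAt d x)

  dec-enc : ∀ x → dec (enc x) ≡ x
  dec-enc center   = refl
  dec-enc (leaf t) rewrite splitAt-↑ˡ d t (i + i) = refl
  dec-enc (knee j) rewrite splitAt-↑ʳ d (i + i) (j ↑ˡ i) | splitAt-↑ˡ i j i = refl
  dec-enc (foot j) rewrite splitAt-↑ʳ d (i + i) (i ↑ʳ j) | splitAt-↑ʳ i i j = refl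

  enc-leg-vertex : ∀ y → enc (leg-vertex y) ≡ suc (d ↑ʳ join i i y)
  enc-leg-vertex (inj₁ j) = refl
  enc-leg-vertex (inj₂ j) = refl

  enc-outer-vertex : ∀ y → enc (outer-vertex y) ≡ suc (join d (i + i) y)
  enc-outer-vertex (inj₁ t) = refl
  enc-outer-vertex (inj₂ y) =
    trans (enc-leg-vertex (splitAt i y)) (cong (λ z → suc (d ↑ʳ z)) (join-splitAt i i y))

  enc-dec : ∀ u → enc (dec u) ≡ u
  enc-dec zero    = refl
  enc-dec (suc x) = trans (enc-outer-vertex (splitAt d x)) (cong suc (join-splitAt d (i + i) x))

  Adjacent : V → V → Set
  Adjacent center   (leaf _)  = ⊤
  Adjacent (leaf _) center    = ⊤
  Adjacent center   (knee _)  = ⊤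
  Adjacent (knee _) center    = ⊤
  Adjacent (knee j) (foot k)  = j ≡ k
  Adjacent (foot j) (knee k)  = j ≡ k
  Adjacent _        _         = ⊥

  adjacent-sym : ∀ {x y} → Adjacent x y → Adjacent y x
  adjacent-sym {center} {leaf _} _ = tt
  adjacent-sym {center} {knee _} _ = tt
  adjacent-sym {leaf _} {center} _ = tt
  adjacent-sym {knee _} {center} _ = tt
  adjacent-sym {knee _} {foot _} j≡k = sym j≡k
  adjacent-sym {foot _} {knee _} j≡k = sym j≡k

  adjacent-irrefl : ∀ {x} → ¬ Adjacent x x
  adjacent-irrefl {center} ()
  adjacent-irrefl {leaf _} ()
  adjacent-irrefl {knee _} ()
  adjacent-irrefl {foot _} ()

  open Presented enc dec dec-enc enc-dec Adjacent adjacent-sym adjacent-irrefl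

  leaf-neighbour : ∀ t x → Adjacent (leaf t) x → x ≡ center
  leaf-neighbour t center _ = refl

  foot-neighbour : ∀ j x → Adjacent (foot j) x → x ≡ knee j
  foot-neighbour j (knee k) refl = refl

  knee-neighbour : ∀ j x → Adjacent (knee j) x → x ≡ center ⊎ x ≡ foot j
  knee-neighbour j center   _    = inj₁ refl
  knee-neighbour j (foot k) refl = inj₂ refl

  three-neighbours⇒center : ∀ x a b c → Adjacent x a → Adjacent x b → Adjacent x c →
    a ≢ b → a ≢ c → b ≢ c → x ≡ center
  three-neighbours⇒center center _ _ _ _ _ _ _ _ _ = refl
  three-neighbours⇒center (leaf t) a b _ xa xb _ a≢b _ _ =
    ⊥-elim (a≢b (trans (leaf-neighbour t a xa) (sym (leaf-neighbour t b xb))))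
  three-neighbours⇒center (foot j) a b _ xa xb _ a≢b _ _ =
    ⊥-elim (a≢b (trans (foot-neighbour j a xa) (sym (foot-neighbour j b xb))))
  three-neighbours⇒center (knee j) a b c xa xb xc a≢b a≢c b≢c
    with knee-neighbour j a xa | knee-neighbour j b xb | knee-neighbour j c xc
  ... | inj₁ a≡ | inj₁ b≡ | _      = ⊥-elim (a≢b (trans a≡ (sym b≡)))
  ... | inj₂ a≡ | inj₂ b≡ | _      = ⊥-elim (a≢b (trans a≡ (sym b≡)))
  ... | inj₁ a≡ | inj₂ _  | inj₁ c≡ = ⊥-elim (a≢c (trans a≡ (sym c≡)))
  ... | inj₁ _  | inj₂ b≡ | inj₂ c≡ = ⊥-elim (b≢c (trans b≡ (sym c≡)))
  ... | inj₂ _  | inj₁ b≡ | inj₁ c≡ = ⊥-elim (b≢c (trans b≡ (sym c≡)))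
  ... | inj₂ a≡ | inj₁ _  | inj₂ c≡ = ⊥-elim (a≢c (trans a≡ (sym c≡)))

  spider : Graph (suc n)
  spider = graph

  reach-from-center : ∀ x → Reach spider (enc center) (enc x)
  reach-from-center center   = here
  reach-from-center (leaf t) = step here (adj-enc {center} {leaf t} tt)
  reach-from-center (knee j) = step here (adj-enc {center} {knee j} tt)
  reach-from-center (foot j) = step (reach-from-center (knee j)) (adj-enc {knee j} {foot j} refl)

  spider-connected : Connected spider
  spider-connected = connected-from center reach-from-center

  Piece : Set
  Piece = Fin d ⊎ Fin i

  piece-length : Piece → ℕ
  piece-length (inj₁ _) = 1
  piece-length (inj₂ _) = 2

  piece-walk : ∀ z → Fin (suc (piece-length z)) → V
  piece-walk (inj₁ t) zero              = center
  piece-walk (inj₁ t) (suc zero)        = leaf t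
  piece-walk (inj₂ j) zero              = center
  piece-walk (inj₂ j) (suc zero)        = knee j
  piece-walk (inj₂ j) (suc (suc zero))  = foot j

  depth : V → ℕ
  depth center   = 0
  depth (leaf _) = 1
  depth (knee _) = 1
  depth (foot _) = 2

  depth-piece-walk : ∀ z p → depth (piece-walk z p) ≡ toℕ p
  depth-piece-walk (inj₁ t) zero             = refl
  depth-piece-walk (inj₁ t) (suc zero)       = refl
  depth-piece-walk (inj₂ j) zero             = refl
  depth-piece-walk (inj₂ j) (suc zero)       = refl
  depth-piece-walk (inj₂ j) (suc (suc zero)) = refl

  piece-walk-injective : ∀ z p q → piece-walk z p ≡ piece-walk z q → p ≡ q
  piece-walk-injective z p q e =
    toℕ-injective (trans (sym (depth-piece-walk z p)) (trans (cong depth e) (depth-piece-walk z q)))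

  piece-walk-steps : ∀ z p → Adjacent (piece-walk z (inject₁ p)) (piece-walk z (suc p))
  piece-walk-steps (inj₁ t) zero       = tt
  piece-walk-steps (inj₂ j) zero       = tt
  piece-walk-steps (inj₂ j) (suc zero) = refl

  piece-nonempty : ∀ z → 1 ≤ piece-length z
  piece-nonempty (inj₁ _) = s≤s z≤n
  piece-nonempty (inj₂ _) = s≤s z≤n

  module PieceWalk (z : Piece) = WalkPath (piece-length z) (piece-walk z) (piece-nonempty z)
                                      (piece-walk-steps z) (piece-walk-injective z)

  piece : Piece → GPath spider
  piece = PieceWalk.as-path

  internal-vertex : ∀ z v → Internal (piece z) v → ∃[ j ] (z ≡ inj₂ j × v ≡ enc (knee j))
  internal-vertex (inj₁ t) v (suc zero , _ , s≤s () , _)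
  internal-vertex (inj₂ j) v (suc zero , _ , _ , knee≡v) = j , refl , sym knee≡v
  internal-vertex (inj₂ j) v (suc (suc zero) , _ , s≤s (s≤s ()) , _)

  owner : ∀ x y → Adjacent x y → Piece
  owner center   (leaf t) _ = inj₁ t
  owner (leaf t) center   _ = inj₁ t
  owner center   (knee j) _ = inj₂ j
  owner (knee j) center   _ = inj₂ j
  owner (knee j) (foot _) _ = inj₂ j
  owner (foot _) (knee j) _ = inj₂ j

  owner-contains : ∀ x y p → WalkEdge (piece-walk (owner x y p)) x y
  owner-contains center   (leaf t) _    = zero , inj₁ (refl , refl)
  owner-contains (leaf t) center   _    = zero , inj₂ (refl , refl)
  owner-contains center   (knee j) _    = zero , inj₁ (refl , refl)
  owner-contains (knee j) center   _    = zero , inj₂ (refl , refl)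
  owner-contains (knee j) (foot _) refl = suc zero , inj₁ (refl , refl)
  owner-contains (foot _) (knee j) refl = suc zero , inj₂ (refl , refl)

  owner-unique : ∀ z x y p → WalkEdge (piece-walk z) x y → z ≡ owner x y p
  owner-unique z x y p (q , inj₁ (e₁ , e₂)) = outwards z q e₁ e₂
    where
    outwards : ∀ z q → piece-walk z (inject₁ q) ≡ x → piece-walk z (suc q) ≡ y → z ≡ owner x y p
    outwards (inj₁ t) zero       refl refl = refl
    outwards (inj₂ j) zero       refl refl = refl
    outwards (inj₂ j) (suc zero) refl refl = refl
  owner-unique z x y p (q , inj₂ (e₁ , e₂)) = inwards z q e₁ e₂
    where
    inwards : ∀ z q → piece-walk z (inject₁ q) ≡ y → piece-walk z (suc q) ≡ x → z ≡ owner x y p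
    inwards (inj₁ t) zero       refl refl = refl
    inwards (inj₂ j) zero       refl refl = refl
    inwards (inj₂ j) (suc zero) refl refl = refl

  owner-irrelevant : ∀ x y p q → owner x y p ≡ owner x y q
  owner-irrelevant x y p q = owner-unique (owner x y p) x y q (owner-contains x y p)

  owner-sym : ∀ x y p q → owner x y p ≡ owner y x q
  owner-sym x y p q =
    owner-unique (owner x y p) y x q (walk-edge-sym (piece-walk _) (owner-contains x y p))

  index-of : ∀ {k z} → splitAt d k ≡ z → k ≡ join d i z
  index-of {k} e = trans (sym (join-splitAt d i k)) (cong (join d i) e)

  cover : GraphoidalCover spider
  cover = record
    { size               = d + i
    ; path               = piece ∘ splitAt d
    ; internalAtMostOnce = internal-at-most-once
    ; edgeExactlyOnce    = edge-exactly-once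
    }
    where
    knee-injective : ∀ {j k} → knee j ≡ knee k → j ≡ k
    knee-injective refl = refl

    internal-at-most-once : ∀ v j k → Internal (piece (splitAt d j)) v →
      Internal (piece (splitAt d k)) v → j ≡ k
    internal-at-most-once v j k in-j in-k
      with internal-vertex _ v in-j | internal-vertex _ v in-k
    ... | j' , j-leg , v≡j' | k' , k-leg , v≡k' =
      trans (index-of j-leg)
        (trans (cong (join d i ∘ inj₂) (knee-injective (enc-injective (trans (sym v≡j') v≡k'))))
          (sym (index-of k-leg)))

    edge-exactly-once : ∀ a b (p : Adj spider a b) →
      ∃[ j ] (ContainsEdge (piece (splitAt d j)) a b
             × (∀ k → ContainsEdge (piece (splitAt d k)) a b → k ≡ j))
    edge-exactly-once a b p =
        join d i o
      , subst (λ z → ContainsEdge (piece z) a b) (sym (splitAt-join d i o))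
              (PieceWalk.walk-edge→contains-edge o (owner-contains (dec a) (dec b) p))
      , λ k k-contains →
          index-of (owner-unique _ _ _ p (PieceWalk.contains-edge→walk-edge (splitAt d k) k-contains))
      where
      o = owner (dec a) (dec b) p

  piece-through-center : ∀ z → OnPath (piece z) (enc center)
  piece-through-center (inj₁ _) = zero , refl
  piece-through-center (inj₂ _) = zero , refl

  Ω-distNumber : IsDistNumber (Ω spider cover) (d + i)
  Ω-distNumber = complete-distNumber (Ω spider cover)
    (common-vertex⇒Ω-complete cover (enc center) (piece-through-center ∘ splitAt d))

  piece-label : Piece → Fin d
  piece-label (inj₁ t) = t
  piece-label (inj₂ j) = 3 ↑ʳ j

  edge-label : ∀ x y → Adjacent x y → Fin d
  edge-label x y p = piece-label (owner x y p)

  open Labelling edge-label (λ x y p q → cong piece-label (owner-irrelevant x y p q))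
                            (λ x y p q → cong piece-label (owner-sym x y p q))

  labelled-leg : ∀ j m e → Adjacent center m → (me : Adjacent m e) →
    edge-label m e me ≡ 3 ↑ʳ j → e ≢ center → m ≡ knee j × e ≡ foot j
  labelled-leg j (leaf t) e        _ me   _     e≢center = ⊥-elim (e≢center (leaf-neighbour t e me))
  labelled-leg j (knee k) center   _ _    _     e≢center = ⊥-elim (e≢center refl)
  labelled-leg j (knee k) (foot k) _ refl label _ with ↑ʳ-injective 3 k j label
  ... | refl = refl , refl

  labelled-leaf : ∀ t m (cm : Adjacent center m) → edge-label center m cm ≡ t →
    (∀ k → m ≢ knee k) → m ≡ leaf t
  labelled-leaf t (leaf _) _ label _        = cong leaf label
  labelled-leaf t (knee k) _ _     not-knee = ⊥-elim (not-knee k refl)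

  -- The labelled spider is rigid: the centre is the only vertex of degree
  -- ≥ 3 (d ≥ 3), the labels 3 + j pin down the legs, and the labels t pin
  -- down the leaves.
  spider-rigid : LabelRigid
  spider-rigid s s-adj s-injective s-label = fixed
    where
    s-distinct : ∀ {x y} → x ≢ y → s x ≢ s y
    s-distinct x≢y e = x≢y (s-injective e)

    center-fixed : s center ≡ center
    center-fixed = three-neighbours⇒center (s center)
      (s (leaf zero)) (s (leaf (suc zero))) (s (leaf (suc (suc zero))))
      (s-adj tt) (s-adj tt) (s-adj tt) (s-distinct (λ ())) (s-distinct (λ ())) (s-distinct (λ ()))

    from-center : ∀ {x} → Adjacent center x → Adjacent center (s x)
    from-center {x} cx = subst (λ c → Adjacent c (s x)) center-fixed (s-adj cx)

    leg-fixed : ∀ j → s (knee j) ≡ knee j × s (foot j) ≡ foot j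
    leg-fixed j = labelled-leg j _ _ (from-center tt) (s-adj refl)
      (s-label (knee j) (foot j) refl (s-adj refl))
      (λ e → s-distinct (λ ()) (trans e (sym center-fixed)))

    leaf-fixed : ∀ t → s (leaf t) ≡ leaf t
    leaf-fixed t = labelled-leaf t (s (leaf t)) (from-center tt)
      (trans (L-along (sym center-fixed) refl _ (s-adj tt)) (s-label center (leaf t) tt (s-adj tt)))
      (λ k e → s-distinct (λ ()) (trans e (sym (proj₁ (leg-fixed k)))))

    fixed : ∀ x → s x ≡ x
    fixed center   = center-fixed
    fixed (leaf t) = leaf-fixed t
    fixed (knee j) = proj₁ (leg-fixed j)
    fixed (foot j) = proj₂ (leg-fixed j)

  leaf-pendant : ∀ t w → Adj spider (enc (leaf t)) w → w ≡ enc center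
  leaf-pendant t w p = trans (sym (enc-dec w)) (cong enc (leaf-neighbour t (dec w) (adj-from-enc {leaf t} {w} p)))

  leaf-injective : ∀ {t t'} → enc (leaf t) ≡ enc (leaf t') → t ≡ t'
  leaf-injective e with enc-injective {leaf _} {leaf _} e
  ... | refl = refl

  spider-distIndex : IsDistIndex spider d
  spider-distIndex =
      (induced-labelling , rigid⇒distinguishing spider-rigid)
    , pendant-lower-bound spider (enc center) (enc ∘ leaf) (λ t → adj-enc {center} {leaf t} tt)
                          leaf-pendant leaf-injective

mainTheorem8 : ∀ (i : ℕ) → ∃[ n ] Σ (Graph (suc n)) λ G → Connected G ×
    Σ (GraphoidalCover G) λ ψ → ∃[ d ] ∃[ r ]
      (IsDistIndex G d × IsDistNumber (Ω G ψ) r × ∣ d - r ∣ ≡ i)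
mainTheorem8 i =
  n , spider , spider-connected , cover , d , d + i , spider-distIndex , Ω-distNumber , ∣m-m+n∣≡n d i
  where open Spider i
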